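{- A finite set $\Sigma$ of Datalog$^\exists$ rules is both Warded Datalog$^\pm$ and Shy Datalog$^\exists$ if and only if it is Protected Datalog$^\pm$. That is, $\mathsf{warded}\cap\mathsf{shy}=\mathsf{protected}$.
   Context: A Datalog$^\exists$ rule is a formula $\forall \bar x\forall \bar y\,(\varphi(\bar x,\bar y)\to\exists \bar z\,\psi(\bar x,\bar z))$ with $\varphi$ (body) and $\psi$ (head) conjunctions of relational atoms whose terms are constants or variables; variables of $\bar z$ are $\exists$-variables, the others $\forall$-variables. A position $p[i]$ is the $i$-th argument of predicate $p$. Given a set $\Sigma$ of rules: $p[i]$ is affected if (i) some rule of $\Sigma$ has an $\exists$-variable at position $p[i]$ in its head, or (ii) some rule of $\Sigma$ has a $\forall$-variable occurring in its body only in affected positions and occurring at $p[i]$ in its head (least set closed under these). For an $\exists$-variable $y$ of $\Sigma$, $p[i]$ is invaded by $y$ if there is a rule $\rho\in\Sigma$ with head atom $p(t_1,\dots,t_k)$ such that either $t_i=y$, or $t_i$ is a $\forall$-variable occurring in the body of $\rho$ only in positions invaded by $y$ (least set closed under these); invaded positions are affected. A variable $x$ of a conjunction of atoms is attacked by $y$ in that conjunction if $x$ occurs in it only in positions invaded by $y$; $x$ is protected if it is attacked by no variable. $\mathsf{shy}$ (Shy Datalog$^\exists$) is the class of $\Sigma$ such that for every rule $\sigma\in\Sigma$: (S1) every variable occurring in more than one body atom of $\sigma$ is protected in the body of $\sigma$; (S2) if two distinct $\forall$-variables are not protected in the body of $\sigma$ but both occur in the head of $\sigma$ and in two different body atoms,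 then they are not attacked by the same variable. A $\forall$-variable $x$ of a rule $\rho$ is harmful (w.r.t. $\rho$) if it appears in $\rho$'s body only in affected positions, otherwise harmless; a harmful variable occurring in the head is dangerous. $\mathsf{warded}$ (Warded Datalog$^\pm$) is the class of $\Sigma$ such that for every rule $\sigma\in\Sigma$: (W1) all dangerous variables of $\sigma$ appear in a single body atom, called the ward; (W2) the ward shares only harmless variables with the other body atoms. A harmful $\forall$-variable of a rule $\rho$ is attacked harmful if all the (affected) body positions in which it occurs are invaded by one and the same $\exists$-variable, and protected harmful otherwise. A rule contains an attacked harmful join if some attacked harmful variable occurs in more than one of its body atoms. $\mathsf{protected}$ (Protected Datalog$^\pm$) is the class of $\Sigma$ such that every rule $\sigma\in\Sigma$ (P1) contains no attacked harmful join, and (P2) satisfies (W1) and (W2). -}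

module Defs where

open import Data.Nat using (ℕ)
open import Data.Fin using (Fin; toℕ)
open import Data.List using (List; length; lookup)
open import Data.List.Membership.Propositional using (_∈_)
open import Data.Product using (Σ; ∃; ∃-syntax; _×_; _,_)
open import Data.Sum using (_⊎_)
open import Relation.Nullary using (¬_)
open import Relation.Binary.PropositionalEquality using (_≡_; _≢_)

Pred : Set
Pred = ℕ

Var : Set
Var = ℕ

data Term : Set where
  const : ℕ → Term
  var   : Var → Term

record Atom : Set where
  constructor atom
  field
    pred : Pred
    args : List Term
open Atom public

-- A rule  body → ∃ z̄ head.  The ∀-variables are the variables of the body,
-- the ∃-variables are the variables of the head not occurring in the body.
record Rule : Set where
  constructor _⇒_
  field
    body : List Atom
    head : List Atom
open Rule public

Program : Set
Program = List Rule

-- A position p[i]: predicate p, argument index i (counted from 0).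
Pos : Set
Pos = Pred × ℕ

OccAtom : Atom → Var → Pos → Set
OccAtom a x pos =
  Σ (Fin (length (args a))) λ i →
    (lookup (args a) i ≡ var x) × (pos ≡ (pred a , toℕ i))

InAtom : Atom → Var → Set
InAtom a x = ∃[ pos ] OccAtom a x pos

OccIn : List Atom → Var → Pos → Set
OccIn C x pos = Σ Atom λ a → (a ∈ C) × OccAtom a x pos

InConj : List Atom → Var → Set
InConj C x = ∃[ pos ] OccIn C x pos

IsUniv : Rule → Var → Set
IsUniv ρ x = InConj (body ρ) x

IsExist : Rule → Var → Set
IsExist ρ z = InConj (head ρ) z × ¬ InConj (body ρ) z

data Affected (Σ' : Program) : Pos → Set where
  aff-∃ : ∀ {ρ z pos} → ρ ∈ Σ' → IsExist ρ z → OccIn (head ρ) z pos →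
          Affected Σ' pos
  aff-∀ : ∀ {ρ x pos} → ρ ∈ Σ' → IsUniv ρ x →
          (∀ q → OccIn (body ρ) x q → Affected Σ' q) →
          OccIn (head ρ) x pos → Affected Σ' pos

-- ∃-variables of Σ, kept apart by the index of the rule they belong to
-- (rules are implicitly standardised apart).
record ExVar (Σ' : Program) : Set where
  constructor exvar
  field
    rule  : Fin (length Σ')
    name  : Var
    isExist : IsExist (lookup Σ' rule) name
open ExVar public

data Invaded (Σ' : Program) (y : ExVar Σ') : Pos → Set where
  inv-∃ : ∀ {pos} → OccIn (head (lookup Σ' (rule y))) (name y) pos →
          Invaded Σ' y pos
  inv-∀ : ∀ {ρ x pos} → ρ ∈ Σ' → IsUniv ρ x →
          (∀ q → OccIn (body ρ) x q → Invaded Σ' y q) →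
          OccIn (head ρ) x pos → Invaded Σ' y pos

Attacked : (Σ' : Program) → ExVar Σ' → Var → List Atom → Set
Attacked Σ' y x C = InConj C x × (∀ q → OccIn C x q → Invaded Σ' y q)

Protected : Program → Var → List Atom → Set
Protected Σ' x C = InConj C x × (∀ y → ¬ Attacked Σ' y x C)

InTwoAtoms : List Atom → Var → Set
InTwoAtoms C x = Σ (Fin (length C)) λ i → Σ (Fin (length C)) λ j →
  (i ≢ j) × InAtom (lookup C i) x × InAtom (lookup C j) x

ShyRule : Program → Rule → Set
ShyRule Σ' σ =
  (∀ x → InTwoAtoms (body σ) x → Protected Σ' x (body σ)) ×
  (∀ x x' → x ≢ x' → IsUniv σ x → IsUniv σ x' →
     ¬ Protected Σ' x (body σ) → ¬ Protected Σ' x' (body σ) →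
     InConj (head σ) x → InConj (head σ) x' →
     (Σ (Fin (length (body σ))) λ i → Σ (Fin (length (body σ))) λ j →
        (i ≢ j) × InAtom (lookup (body σ) i) x × InAtom (lookup (body σ) j) x') →
     ¬ (Σ (ExVar Σ') λ y → Attacked Σ' y x (body σ) × Attacked Σ' y x' (body σ)))

IsShy : Program → Set
IsShy Σ' = ∀ σ → σ ∈ Σ' → ShyRule Σ' σ

Harmful : Program → Rule → Var → Set
Harmful Σ' ρ x = IsUniv ρ x × (∀ q → OccIn (body ρ) x q → Affected Σ' q)

Harmless : Program → Rule → Var → Set
Harmless Σ' ρ x = IsUniv ρ x × ¬ Harmful Σ' ρ x

Dangerous : Program → Rule → Var → Set
Dangerous Σ' ρ x = Harmful Σ' ρ x × InConj (head ρ) x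

IsWard : Program → (σ : Rule) → Fin (length (body σ)) → Set
IsWard Σ' σ w =
  (∀ x → Dangerous Σ' σ x → InAtom (lookup (body σ) w) x) ×
  (∀ x j → j ≢ w → InAtom (lookup (body σ) w) x →
     InAtom (lookup (body σ) j) x → Harmless Σ' σ x)

WardedRule : Program → Rule → Set
WardedRule Σ' σ =
  (∀ x → ¬ Dangerous Σ' σ x) ⊎ (Σ (Fin (length (body σ))) λ w → IsWard Σ' σ w)

IsWarded : Program → Set
IsWarded Σ' = ∀ σ → σ ∈ Σ' → WardedRule Σ' σ

AttackedHarmful : Program → Rule → Var → Set
AttackedHarmful Σ' ρ x =
  Harmful Σ' ρ x × (Σ (ExVar Σ') λ y → ∀ q → OccIn (body ρ) x q → Invaded Σ' y q)

HasAttackedHarmfulJoin : Program → Rule → Set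
HasAttackedHarmfulJoin Σ' ρ =
  ∃[ x ] (AttackedHarmful Σ' ρ x × InTwoAtoms (body ρ) x)

ProtectedRule : Program → Rule → Set
ProtectedRule Σ' σ = ¬ HasAttackedHarmfulJoin Σ' σ × WardedRule Σ' σ

IsProtected : Program → Set
IsProtected Σ' = ∀ σ → σ ∈ Σ' → ProtectedRule Σ' σ

{-# OPTIONS --safe #-}
module Submission where

open import Defs
open import Data.Product using (Σ; _×_; _,_; proj₂)
open import Data.Sum using (inj₁; inj₂)
open import Data.Empty using (⊥-elim)
open import Data.Fin using (Fin; _≟_)
open import Data.List using (length; lookup)
open import Relation.Nullary using (¬_; yes; no)
open import Relation.Binary.PropositionalEquality using (_≡_; _≢_; trans; sym)
open import Data.List.Membership.Propositional.Properties using (∈-lookup)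
open import Function.Bundles using (_⇔_; mk⇔)

-- A variable attacked in the body is exactly an attacked harmful variable, so (S1)
-- and (P1) say the same thing; and two harmful head variables in distinct body atoms
-- are excluded by the ward, which gives (S2).

Invaded⇒Affected : ∀ {Σ' y pos} → Invaded Σ' y pos → Affected Σ' pos
Invaded⇒Affected {y = y} (inv-∃ o) = aff-∃ (∈-lookup (rule y)) (isExist y) o
Invaded⇒Affected (inv-∀ ρ∈Σ u invaded o) =
  aff-∀ ρ∈Σ u (λ q oq → Invaded⇒Affected (invaded q oq)) o

attacked⇒harmful : ∀ {Σ' ρ x} y → Attacked Σ' y x (body ρ) → Harmful Σ' ρ x
attacked⇒harmful y (u , invaded) = u , λ q oq → Invaded⇒Affected (invaded q oq)

attacked⇒attackedHarmful : ∀ {Σ' ρ x} y → Attacked Σ' y x (body ρ) → AttackedHarmful Σ' ρ x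
attacked⇒attackedHarmful {ρ = ρ} y attacked@(_ , invaded) =
  attacked⇒harmful {ρ = ρ} y attacked , y , invaded

InTwoAtoms⇒InConj : ∀ {C x} → InTwoAtoms C x → InConj C x
InTwoAtoms⇒InConj (i , _ , _ , (pos , o) , _) = pos , _ , ∈-lookup i , o

dangerous⇒only-in-ward : ∀ {Σ' σ x} (w : Fin (length (body σ))) → IsWard Σ' σ w →
  Dangerous Σ' σ x → ∀ j → InAtom (lookup (body σ) j) x → j ≡ w
dangerous⇒only-in-ward w (w1 , w2) d@(harmful , _) j x∈j with j ≟ w
... | yes j≡w = j≡w
... | no j≢w = ⊥-elim (proj₂ (w2 _ j j≢w (w1 _ d) x∈j) harmful)

dangerous-in-same-atom : ∀ {Σ' σ x x'} → WardedRule Σ' σ →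
  Dangerous Σ' σ x → Dangerous Σ' σ x' → ∀ i j →
  InAtom (lookup (body σ) i) x → InAtom (lookup (body σ) j) x' → i ≡ j
dangerous-in-same-atom (inj₁ noDangerous) d _ _ _ _ _ = ⊥-elim (noDangerous _ d)
dangerous-in-same-atom (inj₂ (w , ward)) d d' i j x∈i x'∈j =
  trans (dangerous⇒only-in-ward w ward d i x∈i) (sym (dangerous⇒only-in-ward w ward d' j x'∈j))

shy⇒noAttackedHarmfulJoin : ∀ {Σ' σ} → ShyRule Σ' σ → ¬ HasAttackedHarmfulJoin Σ' σ
shy⇒noAttackedHarmfulJoin (s1 , _) (x , ((u , _) , y , invaded) , two) =
  proj₂ (s1 x two) y (u , invaded)

protected⇒shy : ∀ {Σ' σ} → ProtectedRule Σ' σ → ShyRule Σ' σ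
protected⇒shy {Σ'} {σ} (noJoin , warded) = s1 , s2
  where
  s1 : ∀ x → InTwoAtoms (body σ) x → Protected Σ' x (body σ)
  s1 x two = InTwoAtoms⇒InConj two ,
    λ y attacked → noJoin (x , attacked⇒attackedHarmful {ρ = σ} y attacked , two)
  s2 : ∀ x x' → x ≢ x' → IsUniv σ x → IsUniv σ x' →
       ¬ Protected Σ' x (body σ) → ¬ Protected Σ' x' (body σ) →
       InConj (head σ) x → InConj (head σ) x' →
       (Σ (Fin (length (body σ))) λ i → Σ (Fin (length (body σ))) λ j →
          (i ≢ j) × InAtom (lookup (body σ) i) x × InAtom (lookup (body σ) j) x') →
       ¬ (Σ (ExVar Σ') λ y → Attacked Σ' y x (body σ) × Attacked Σ' y x' (body σ))
  s2 x x' _ _ _ _ _ x∈head x'∈head (i , j , i≢j , x∈i , x'∈j) (y , attacked , attacked') =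
    i≢j (dangerous-in-same-atom warded
      (attacked⇒harmful {ρ = σ} y attacked , x∈head)
      (attacked⇒harmful {ρ = σ} y attacked' , x'∈head)
      i j x∈i x'∈j)

theorem1 : (Σ' : Program) → (IsWarded Σ' × IsShy Σ') ⇔ IsProtected Σ'
theorem1 Σ' = mk⇔
  (λ (warded , shy) σ σ∈Σ → shy⇒noAttackedHarmfulJoin (shy σ σ∈Σ) , warded σ σ∈Σ)
  (λ prot → (λ σ σ∈Σ → proj₂ (prot σ σ∈Σ)) , λ σ σ∈Σ → protected⇒shy (prot σ σ∈Σ))
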